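{- Let $p$ be an odd prime and $P\in\mathfrak{B}_{p,2}(n,m)$. (1) If $P=JK$ is a central decomposition, then with $J'=J[P,P]$ and $K'=K[P,P]$, $J'$ and $K'$ form a central decomposition of $P$, and both properly contain $[P,P]$. (2) If $N$ is a central subgroup of $P$ such that $P/N$ admits a central decomposition, then $P/(N\cap[P,P])$ admits a central decomposition. (3) For every $g\in P$, $\deg(g)\leq n-1$.
   Context: $\mathfrak{B}_{p,2}(n,m)$ is the class of non-abelian finite groups $P$ of exponent $p$ with $[P,P]\leq\mathrm{Z}(P)$, $|P/[P,P]|=p^n$ and $|[P,P]|=p^m$. A central decomposition of a group $H$ is a pair of non-trivial proper subgroups $J,K\leq H$ with $[J,K]=1$ and $H=JK$; $H$ admits a central decomposition if such a pair exists. For $g\in P$ with $|C_P(g)|=p^d$, where $C_P(g)=\{h\in P:[h,g]=1\}$, $\deg(g)=n+m-d$. -}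

module Defs where

open import Data.Nat using (ℕ; zero; suc; _+_; _*_; _∸_; _^_; _≤_)
open import Data.Nat.Primality using (Prime)
open import Data.Fin using (Fin)
open import Data.Fin.Properties using (any?) renaming (_≟_ to _≟ᶠ_)
open import Data.Fin.Subset using (Subset; _∈_; _∉_; _⊆_; _⊂_; _∩_; ∣_∣; inside; outside)
open import Data.Fin.Subset.Properties using (_∈?_)
open import Data.Vec using (tabulate)
open import Data.Bool using (Bool; true; false)
open import Data.Product using (Σ; ∃; _×_; _,_)
open import Relation.Nullary using (¬_; does)
open import Relation.Nullary.Decidable using (_×-dec_)
open import Relation.Binary.PropositionalEquality using (_≡_; _≢_)
open import Function.Bundles using (_⇔_)

-- A finite group, presented (up to isomorphism) on the carrier Fin order,
-- with equality the propositional equality of Fin.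
record FinGroup : Set where
  field
    order : ℕ
    _·_   : Fin order → Fin order → Fin order
    e     : Fin order
    inv   : Fin order → Fin order
    assoc : ∀ x y z → (x · y) · z ≡ x · (y · z)
    idˡ   : ∀ x → e · x ≡ x
    idʳ   : ∀ x → x · e ≡ x
    invˡ  : ∀ x → inv x · x ≡ e
    invʳ  : ∀ x → x · inv x ≡ e

  infixl 7 _·_

  El : Set
  El = Fin order

  pow : El → ℕ → El
  pow g zero    = e
  pow g (suc k) = g · pow g k

  comm : El → El → El
  comm x y = inv x · inv y · x · y

  IsSubgroup : Subset order → Set
  IsSubgroup S = (e ∈ S) × (∀ x y → x ∈ S → y ∈ S → x · y ∈ S)
                         × (∀ x → x ∈ S → inv x ∈ S)

  IsDerivedSubgroup : Subset order → Set
  IsDerivedSubgroup D =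
    IsSubgroup D × (∀ x y → comm x y ∈ D)
    × (∀ S → IsSubgroup S → (∀ x y → comm x y ∈ S) → D ⊆ S)

  prodSet : Subset order → Subset order → Subset order
  prodSet J K = tabulate λ g →
    does (any? λ j → any? λ k → (j ∈? J) ×-dec ((k ∈? K) ×-dec (g ≟ᶠ j · k)))

  centralizer : El → Subset order
  centralizer g = tabulate λ h → does ((h · g) ≟ᶠ (g · h))

  IsCentral : Subset order → Set
  IsCentral S = ∀ x → x ∈ S → ∀ g → x · g ≡ g · x

  IsCentralDecomposition : Subset order → Subset order → Set
  IsCentralDecomposition J K =
    IsSubgroup J × IsSubgroup K
    × (∃ λ x → x ∈ J × x ≢ e) × (∃ λ x → x ∈ K × x ≢ e)
    × (∃ λ x → x ∉ J) × (∃ λ x → x ∉ K)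
    × (∀ j k → j ∈ J → k ∈ K → comm j k ≡ e)
    × (∀ g → ∃ λ j → ∃ λ k → j ∈ J × k ∈ K × g ≡ j · k)

  AdmitsCentralDecomposition : Set
  AdmitsCentralDecomposition = ∃ λ J → ∃ λ K → IsCentralDecomposition J K

open FinGroup public

IsHom : (G H : FinGroup) → (El G → El H) → Set
IsHom G H φ = ∀ x y → φ (_·_ G x y) ≡ _·_ H (φ x) (φ y)

-- "G/N admits a central decomposition": some quotient G/N (realised as the
-- image of a surjective homomorphism with kernel exactly N) admits one.
QuotientAdmitsCD : (G : FinGroup) → Subset (order G) → Set
QuotientAdmitsCD G N =
  Σ FinGroup λ Q → Σ (El G → El Q) λ φ →
    IsHom G Q φ
    × (∀ y → ∃ λ x → φ x ≡ y)
    × (∀ x → (φ x ≡ e Q) ⇔ (x ∈ N))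
    × AdmitsCentralDecomposition Q

-- P ∈ 𝔅_{p,2}(n,m), with D = [P,P]
InB : (p n m : ℕ) (P : FinGroup) (D : Subset (order P)) → Set
InB p n m P D =
  (∃ λ x → ∃ λ y → _·_ P x y ≢ _·_ P y x)
  × (∀ g → pow P g p ≡ e P)
  × IsCentral P D
  × (order P ≡ p ^ n * ∣ D ∣)                             -- |P/[P,P]| = p^n
  × (∣ D ∣ ≡ p ^ m)

-- So JD
--       and KD commute and cover P; JD is proper, since JD = P would force
--       D ⊆ J; and D ⊊ JD, since J ⊆ D would make J central and force
--       D ⊆ K, hence P = JK = K.
--   (2) P/(N ∩ D) maps onto P/N and a central decomposition of P/N pulls
--       back along this map: the commutator of two lifts lies in D, and in
--       N since it maps to a commutator of the commuting factors.  The
--       quotient by the central subgroup N ∩ D is built explicitly on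
--       canonical coset representatives.
--   (3) C_P(g) = P if g ∈ D and D ⊊ C_P(g) otherwise; comparing orders
--       (p^(n+m) ≤ p^d, resp. p^m < p^d) bounds the degree.
module Submission where

open import Defs
open import Data.Nat using (ℕ; _+_; _∸_; _^_; _≤_)
open import Data.Nat.Primality using (Prime)
open import Data.Fin.Subset using (Subset; _⊂_; _∩_; ∣_∣)
open import Data.Product using (_×_; _,_)
open import Relation.Nullary using (¬_)
open import Relation.Binary.PropositionalEquality using (_≡_)

open import Level using (0ℓ)
open import Algebra.Bundles using (Group)
open import Data.Bool using (Bool; true; false; if_then_else_)
open import Data.Empty using (⊥-elim)
import Data.Nat as ℕ
open import Data.Nat using (_*_; _<_; suc; z≤n; nonTrivial⇒n>1)
open import Data.Nat.Properties
  using (^-monoʳ-≤; ^-monoʳ-<; ≮⇒≥; <⇒≱; ≰⇒>; ^-distribˡ-+-*; m≤n⇒m∸n≡0; ∸-monoʳ-≤;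
         +-comm; ∸-+-assoc; m+n∸n≡m; module ≤-Reasoning)
open import Data.Nat.Primality using (prime⇒nonTrivial)
open import Data.Fin using (Fin; zero; suc)
open import Data.Fin.Properties using (any?; ¬∀⟶∃¬) renaming (_≟_ to _≟ᶠ_)
open import Data.Fin.Subset using (_∈_; _∉_; _⊆_; ⊤; inside; outside)
open import Data.Fin.Subset.Properties
  using (_∈?_; ∈⊤; ∣⊤∣≡n; p⊆q⇒∣p∣≤∣q∣; p⊂q⇒∣p∣<∣q∣; x∈p∩q⁺; x∈p∩q⁻)
open import Data.Maybe using (Maybe; just; nothing; fromMaybe)
import Data.Maybe as Maybe
open import Data.Product using (∃; proj₁; proj₂)
open import Data.Vec using (tabulate; []; _∷_; here; there)
open import Data.Vec.Properties using ([]=⇒lookup; lookup⇒[]=; lookup∘tabulate)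
open import Data.Vec.Properties.WithK using ([]=-irrelevant)
open import Function using (_∘_)
open import Function.Bundles using (_⇔_; mk⇔; Equivalence)
open import Relation.Nullary using (Dec; does; yes; no)
open import Relation.Nullary.Decidable using (dec-true; does-⇔; decidable-stable; _×-dec_; _→-dec_)
open import Relation.Unary using (Pred; Decidable)
import Relation.Binary.PropositionalEquality as Eq
open Eq using (_≢_; refl; sym; trans; cong; cong₂; subst; subst₂; module ≡-Reasoning)

asGroup : FinGroup → Group 0ℓ 0ℓ
asGroup G = record
  { Carrier = El G ; _≈_ = _≡_ ; _∙_ = _·_ G ; ε = e G ; _⁻¹ = inv G
  ; isGroup = record
    { isMonoid = record
      { isSemigroup = record
        { isMagma = record { isEquivalence = Eq.isEquivalence ; ∙-cong = cong₂ (_·_ G) }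
        ; assoc = assoc G }
      ; identity = idˡ G , idʳ G }
    ; inverse = invˡ G , invʳ G
    ; ⁻¹-cong = cong (inv G) } }

module GroupLaws (G : FinGroup) where
  open Group (asGroup G) public
    using (_∙_; ε; _⁻¹; identityˡ; identityʳ; inverseˡ; inverseʳ)
    renaming (assoc to ∙-assoc)
  open import Algebra.Properties.Group (asGroup G) public
    using (∙-cancelˡ; inverseʳ-unique; ε⁻¹≈ε; ⁻¹-involutive; ⁻¹-anti-homo-∙; \\-leftDividesˡ; \\-leftDividesʳ)
  open ≡-Reasoning

  [_,_] : El G → El G → El G
  [ x , y ] = comm G x y

  Central : El G → Set
  Central a = ∀ g → a ∙ g ≡ g ∙ a

  comm-correction : ∀ x y → y ∙ x ∙ [ x , y ] ≡ x ∙ y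
  comm-correction x y = begin
    y ∙ x ∙ (x ⁻¹ ∙ y ⁻¹ ∙ x ∙ y)     ≡⟨ ∙-assoc (y ∙ x) _ y ⟨
    y ∙ x ∙ (x ⁻¹ ∙ y ⁻¹ ∙ x) ∙ y     ≡⟨ cong (_∙ y) (∙-assoc (y ∙ x) _ x) ⟨
    y ∙ x ∙ (x ⁻¹ ∙ y ⁻¹) ∙ x ∙ y     ≡⟨ cong (λ t → y ∙ x ∙ t ∙ x ∙ y) (⁻¹-anti-homo-∙ y x) ⟨
    y ∙ x ∙ (y ∙ x) ⁻¹ ∙ x ∙ y        ≡⟨ cong (λ t → t ∙ x ∙ y) (inverseʳ (y ∙ x)) ⟩
    ε ∙ x ∙ y                         ≡⟨ cong (_∙ y) (identityˡ x) ⟩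
    x ∙ y                             ∎

  comm-unique : ∀ x y c → y ∙ x ∙ c ≡ x ∙ y → [ x , y ] ≡ c
  comm-unique x y c eq = ∙-cancelˡ (y ∙ x) _ _ (trans (comm-correction x y) (sym eq))

  comm-trivial⇒commute : ∀ x y → [ x , y ] ≡ ε → x ∙ y ≡ y ∙ x
  comm-trivial⇒commute x y eq = begin
    x ∙ y              ≡⟨ comm-correction x y ⟨
    y ∙ x ∙ [ x , y ]  ≡⟨ cong (y ∙ x ∙_) eq ⟩
    y ∙ x ∙ ε          ≡⟨ identityʳ (y ∙ x) ⟩
    y ∙ x              ∎

  central-interchange : ∀ {c} → Central c → ∀ x y c' → x ∙ c ∙ (y ∙ c') ≡ x ∙ y ∙ (c ∙ c')
  central-interchange {c} c-central x y c' = begin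
    x ∙ c ∙ (y ∙ c')     ≡⟨ ∙-assoc x c _ ⟩
    x ∙ (c ∙ (y ∙ c'))   ≡⟨ cong (x ∙_) (∙-assoc c y c') ⟨
    x ∙ (c ∙ y ∙ c')     ≡⟨ cong (λ t → x ∙ (t ∙ c')) (c-central y) ⟩
    x ∙ (y ∙ c ∙ c')     ≡⟨ cong (x ∙_) (∙-assoc y c c') ⟩
    x ∙ (y ∙ (c ∙ c'))   ≡⟨ ∙-assoc x y _ ⟨
    x ∙ y ∙ (c ∙ c')     ∎

  comm-centralˡ : ∀ {a} → Central a → ∀ x y → [ a ∙ x , y ] ≡ [ x , y ]
  comm-centralˡ {a} a-central x y = comm-unique (a ∙ x) y [ x , y ] (begin
    y ∙ (a ∙ x) ∙ [ x , y ]    ≡⟨ cong (_∙ [ x , y ]) (∙-assoc y a x) ⟨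
    y ∙ a ∙ x ∙ [ x , y ]      ≡⟨ cong (λ t → t ∙ x ∙ [ x , y ]) (a-central y) ⟨
    a ∙ y ∙ x ∙ [ x , y ]      ≡⟨ trans (cong (_∙ [ x , y ]) (∙-assoc a y x)) (∙-assoc a _ _) ⟩
    a ∙ (y ∙ x ∙ [ x , y ])    ≡⟨ cong (a ∙_) (comm-correction x y) ⟩
    a ∙ (x ∙ y)                ≡⟨ ∙-assoc a x y ⟨
    a ∙ x ∙ y                  ∎)

  comm-centralʳ : ∀ {a} → Central a → ∀ x y → [ x , a ∙ y ] ≡ [ x , y ]
  comm-centralʳ {a} a-central x y = comm-unique x (a ∙ y) [ x , y ] (begin
    a ∙ y ∙ x ∙ [ x , y ]      ≡⟨ trans (cong (_∙ [ x , y ]) (∙-assoc a y x)) (∙-assoc a _ _) ⟩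
    a ∙ (y ∙ x ∙ [ x , y ])    ≡⟨ cong (a ∙_) (comm-correction x y) ⟩
    a ∙ (x ∙ y)                ≡⟨ ∙-assoc a x y ⟨
    a ∙ x ∙ y                  ≡⟨ cong (_∙ y) (a-central x) ⟩
    x ∙ a ∙ y                  ≡⟨ ∙-assoc x a y ⟩
    x ∙ (a ∙ y)                ∎)

module HomLaws (G H : FinGroup) (φ : El G → El H) (φ-hom : IsHom G H φ) where
  private
    module G = GroupLaws G
    module H = GroupLaws H
  open ≡-Reasoning

  hom-ε : φ G.ε ≡ H.ε
  hom-ε = H.∙-cancelˡ (φ G.ε) _ _ (begin
    φ G.ε H.∙ φ G.ε   ≡⟨ φ-hom G.ε G.ε ⟨
    φ (G.ε G.∙ G.ε)   ≡⟨ cong φ (G.identityˡ G.ε) ⟩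
    φ G.ε             ≡⟨ H.identityʳ (φ G.ε) ⟨
    φ G.ε H.∙ H.ε     ∎)

  hom-⁻¹ : ∀ x → φ (x G.⁻¹) ≡ φ x H.⁻¹
  hom-⁻¹ x = H.inverseʳ-unique (φ x) (φ (x G.⁻¹))
    (trans (sym (φ-hom x (x G.⁻¹))) (trans (cong φ (G.inverseʳ x)) hom-ε))

  hom-comm : ∀ x y → φ G.[ x , y ] ≡ H.[ φ x , φ y ]
  hom-comm x y = begin
    φ (x G.⁻¹ G.∙ y G.⁻¹ G.∙ x G.∙ y)            ≡⟨ φ-hom _ y ⟩
    φ (x G.⁻¹ G.∙ y G.⁻¹ G.∙ x) H.∙ φ y          ≡⟨ cong (H._∙ φ y) (φ-hom _ x) ⟩
    φ (x G.⁻¹ G.∙ y G.⁻¹) H.∙ φ x H.∙ φ y        ≡⟨ cong (λ t → t H.∙ φ x H.∙ φ y) (φ-hom _ _) ⟩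
    φ (x G.⁻¹) H.∙ φ (y G.⁻¹) H.∙ φ x H.∙ φ y    ≡⟨ cong₂ (λ s t → s H.∙ t H.∙ φ x H.∙ φ y) (hom-⁻¹ x) (hom-⁻¹ y) ⟩
    H.[ φ x , φ y ]                              ∎

  hom-coset : ∀ x y → φ (x G.⁻¹ G.∙ y) ≡ H.ε → φ x ≡ φ y
  hom-coset x y eq = begin
    φ x                               ≡⟨ H.identityʳ (φ x) ⟨
    φ x H.∙ H.ε                       ≡⟨ cong (φ x H.∙_) eq ⟨
    φ x H.∙ φ (x G.⁻¹ G.∙ y)          ≡⟨ cong (φ x H.∙_) (trans (φ-hom _ y) (cong (H._∙ φ y) (hom-⁻¹ x))) ⟩
    φ x H.∙ (φ x H.⁻¹ H.∙ φ y)        ≡⟨ H.\\-leftDividesˡ (φ x) (φ y) ⟩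
    φ y                               ∎

does⇒ : ∀ {a} {A : Set a} (A? : Dec A) → does A? ≡ true → A
does⇒ (yes a) _ = a
does⇒ (no _) ()

-- The subset of Fin n cut out by a decidable predicate; the subsets
-- prodSet and centralizer of Defs are of this form.
decided : ∀ {n p} {P : Pred (Fin n) p} → Decidable P → Subset n
decided P? = tabulate (λ x → does (P? x))

decided⁺ : ∀ {n p} {P : Pred (Fin n) p} (P? : Decidable P) {x} → P x → x ∈ decided P?
decided⁺ P? {x} px = lookup⇒[]= x _ (trans (lookup∘tabulate _ x) (dec-true (P? x) px))

decided⁻ : ∀ {n p} {P : Pred (Fin n) p} (P? : Decidable P) {x} → x ∈ decided P? → P x
decided⁻ P? {x} x∈ = does⇒ (P? x) (trans (sym (lookup∘tabulate _ x)) ([]=⇒lookup x∈))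

⊈-witness : ∀ {n} {A B : Subset n} → ¬ (A ⊆ B) → ∃ λ x → x ∈ A × x ∉ B
⊈-witness {n} {A} {B} A⊈B =
  let (x , ¬[x∈A⇒x∈B]) = ¬∀⟶∃¬ n _ (λ x → (x ∈? A) →-dec (x ∈? B)) (λ all → A⊈B (all _)) in
  x , decidable-stable (x ∈? A) (λ x∉A → ¬[x∈A⇒x∈B] (λ x∈A → ⊥-elim (x∉A x∈A))) ,
  (λ x∈B → ¬[x∈A⇒x∈B] (λ _ → x∈B))

module Products (G : FinGroup) where
  open GroupLaws G

  Factors : Subset (order G) → Subset (order G) → El G → Set
  Factors A B g = ∃ λ a → ∃ λ b → a ∈ A × b ∈ B × g ≡ a ∙ b

  -- the decision procedure by which Defs defines prodSet G A B
  factors? : ∀ A B → Decidable (Factors A B)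
  factors? A B g = any? λ a → any? λ b → (a ∈? A) ×-dec ((b ∈? B) ×-dec (g ≟ᶠ a ∙ b))

  prodSet⁺ : ∀ {A B g} → Factors A B g → g ∈ prodSet G A B
  prodSet⁺ {A} {B} = decided⁺ (factors? A B)

  prodSet⁻ : ∀ {A B g} → g ∈ prodSet G A B → Factors A B g
  prodSet⁻ {A} {B} = decided⁻ (factors? A B)

  comm-closed : ∀ {S} → IsSubgroup G S → ∀ {x y} → x ∈ S → y ∈ S → [ x , y ] ∈ S
  comm-closed (_ , ∙-closed , ⁻¹-closed) x∈S y∈S =
    ∙-closed _ _ (∙-closed _ _ (∙-closed _ _ (⁻¹-closed _ x∈S) (⁻¹-closed _ y∈S)) x∈S) y∈S

module CentralProducts (G : FinGroup) (C : Subset (order G))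
                       (C≤G : IsSubgroup G C) (C-central : IsCentral G C) where
  open GroupLaws G
  open Products G
  private
    ε∈C = proj₁ C≤G
    ∙-closedC = proj₁ (proj₂ C≤G)
    ⁻¹-closedC = proj₂ (proj₂ C≤G)

  ⊆-product : ∀ {J} → J ⊆ prodSet G J C
  ⊆-product {x = j} j∈J = prodSet⁺ (j , ε , j∈J , ε∈C , sym (identityʳ j))

  comm-product : ∀ {j k c c'} → c ∈ C → c' ∈ C → [ j ∙ c , k ∙ c' ] ≡ [ j , k ]
  comm-product {j} {k} {c} {c'} c∈C c'∈C = begin
    [ j ∙ c , k ∙ c' ]   ≡⟨ cong₂ [_,_] (C-central c c∈C j) (C-central c' c'∈C k) ⟨
    [ c ∙ j , c' ∙ k ]   ≡⟨ comm-centralˡ (C-central c c∈C) j _ ⟩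
    [ j , c' ∙ k ]       ≡⟨ comm-centralʳ (C-central c' c'∈C) j k ⟩
    [ j , k ]            ∎
    where open ≡-Reasoning

  product-subgroup : ∀ {J} → IsSubgroup G J → IsSubgroup G (prodSet G J C)
  product-subgroup {J} (ε∈J , ∙-closedJ , ⁻¹-closedJ) =
    ⊆-product ε∈J ,
    (λ x y x∈ y∈ → ∙-closed (prodSet⁻ x∈) (prodSet⁻ y∈)) ,
    (λ x x∈ → ⁻¹-closed (prodSet⁻ x∈))
    where
    ∙-closed : ∀ {x y} → Factors J C x → Factors J C y → x ∙ y ∈ prodSet G J C
    ∙-closed (j , c , j∈J , c∈C , refl) (j' , c' , j'∈J , c'∈C , refl) =
      prodSet⁺ (j ∙ j' , c ∙ c' , ∙-closedJ _ _ j∈J j'∈J , ∙-closedC _ _ c∈C c'∈C ,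
                central-interchange (C-central c c∈C) j j' c')
    -- (j c)⁻¹ = c⁻¹ j⁻¹ = j⁻¹ c⁻¹, as c⁻¹ ∈ C is central
    ⁻¹-closed : ∀ {x} → Factors J C x → x ⁻¹ ∈ prodSet G J C
    ⁻¹-closed (j , c , j∈J , c∈C , refl) =
      prodSet⁺ (j ⁻¹ , c ⁻¹ , ⁻¹-closedJ _ j∈J , ⁻¹-closedC _ c∈C ,
                trans (⁻¹-anti-homo-∙ j c) (C-central _ (⁻¹-closedC _ c∈C) (j ⁻¹)))

module DerivedProducts (P : FinGroup) (D : Subset (order P))
                       (D-derived : IsDerivedSubgroup P D) (D-central : IsCentral P D) where
  open GroupLaws P
  open Products P
  open CentralProducts P D (proj₁ D-derived) D-central

  derived-minimal : ∀ {S} → IsSubgroup P S → (∀ x y → [ x , y ] ∈ S) → D ⊆ S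
  derived-minimal {S} = proj₂ (proj₂ D-derived) S

  CentralTimes : Subset (order P) → El P → Set
  CentralTimes A g = ∃ λ c → ∃ λ a → Central c × a ∈ A × g ≡ c ∙ a

  derived⊆factor : ∀ {A} → IsSubgroup P A → (∀ g → CentralTimes A g) → D ⊆ A
  derived⊆factor {A} A≤P P=ZA = derived-minimal A≤P comm∈A
    where
    comm∈A : ∀ x y → [ x , y ] ∈ A
    comm∈A x y with P=ZA x | P=ZA y
    ... | c₁ , a₁ , c₁-central , a₁∈A , refl | c₂ , a₂ , c₂-central , a₂∈A , refl =
      subst (_∈ A) (sym (trans (comm-centralˡ c₁-central a₁ _) (comm-centralʳ c₂-central a₁ a₂)))
            (comm-closed A≤P a₁∈A a₂∈A)

  -- If JD were all of P, then D ⊆ J by derived⊆factor, and J = JD = P.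
  product-proper : ∀ {J} → IsSubgroup P J → (∃ λ x → x ∉ J) → ∃ λ x → x ∉ prodSet P J D
  product-proper {J} J≤P (x , x∉J) =
    let (y , _ , y∉JD) = ⊈-witness (λ JD-full → x∉J (J-full JD-full x)) in y , y∉JD
    where
    J-full : ⊤ ⊆ prodSet P J D → ∀ g → g ∈ J
    J-full JD-full g = let (j , d , j∈J , d∈D , g≡jd) = factor g in
      subst (_∈ J) (sym g≡jd) (proj₁ (proj₂ J≤P) j d j∈J (D⊆J d∈D))
      where
      factor : ∀ g → Factors J D g
      factor g = prodSet⁻ (JD-full (∈⊤ {x = g}))
      D⊆J : D ⊆ J
      D⊆J = derived⊆factor J≤P (λ g → let (j , d , j∈J , d∈D , g≡jd) = factor g in
        d , j , D-central d d∈D , j∈J , trans g≡jd (sym (D-central d d∈D j)))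

  -- If P = JK with K proper, then J ⊈ D: otherwise J is central, so
  -- D ⊆ K by derived⊆factor and P = JK ⊆ K.
  derived⊂product : ∀ {J K} → IsSubgroup P J → IsSubgroup P K → (∃ λ x → x ∉ K) →
                    (∀ g → Factors J K g) → D ⊂ prodSet P J D
  derived⊂product {J} {K} J≤P K≤P (x , x∉K) P=JK =
    let (j , j∈J , j∉D) = ⊈-witness (λ J⊆D → x∉K (K-full J⊆D x)) in
    (λ {d} d∈D → prodSet⁺ (ε , d , proj₁ J≤P , d∈D , sym (identityˡ d))) ,
    j , ⊆-product j∈J , j∉D
    where
    K-full : J ⊆ D → ∀ g → g ∈ K
    K-full J⊆D g = let (j , k , j∈J , k∈K , g≡jk) = P=JK g in
      subst (_∈ K) (sym g≡jk) (proj₁ (proj₂ K≤P) j k (D⊆K (J⊆D j∈J)) k∈K)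
      where
      D⊆K : D ⊆ K
      D⊆K = derived⊆factor K≤P (λ g → let (j , k , j∈J , k∈K , g≡jk) = P=JK g in
        j , k , D-central j (J⊆D j∈J) , k∈K , g≡jk)

  swap-factors : ∀ {J K} → (∀ j k → j ∈ J → k ∈ K → [ j , k ] ≡ ε) →
                 (∀ g → Factors J K g) → ∀ g → Factors K J g
  swap-factors [J,K]=1 P=JK g = let (j , k , j∈J , k∈K , eq) = P=JK g in
    k , j , k∈K , j∈J , trans eq (comm-trivial⇒commute j k ([J,K]=1 j k j∈J k∈K))

  decomposition-with-derived : ∀ {J K} → IsCentralDecomposition P J K →
    IsCentralDecomposition P (prodSet P J D) (prodSet P K D)
    × D ⊂ prodSet P J D × D ⊂ prodSet P K D
  decomposition-with-derived {J} {K}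
    (J≤P , K≤P , (x , x∈J , x≢ε) , (y , y∈K , y≢ε) , J-proper , K-proper , [J,K]=1 , P=JK) =
    ( product-subgroup J≤P , product-subgroup K≤P
    , (x , ⊆-product x∈J , x≢ε) , (y , ⊆-product y∈K , y≢ε)
    , product-proper J≤P J-proper , product-proper K≤P K-proper
    , [JD,KD]=1 , (λ g → let (j , k , j∈J , k∈K , eq) = P=JK g in j , k , ⊆-product j∈J , ⊆-product k∈K , eq) )
    , derived⊂product J≤P K≤P K-proper P=JK
    , derived⊂product K≤P J≤P J-proper (swap-factors [J,K]=1 P=JK)
    where
    [JD,KD]=1 : ∀ x y → x ∈ prodSet P J D → y ∈ prodSet P K D → [ x , y ] ≡ ε
    [JD,KD]=1 x y x∈JD y∈KD with prodSet⁻ x∈JD | prodSet⁻ y∈KD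
    ... | j , d , j∈J , d∈D , refl | k , d' , k∈K , d'∈D , refl =
      trans (comm-product d∈D d'∈D) ([J,K]=1 j k j∈J k∈K)

-- The first position at which a boolean test succeeds. It depends only
-- on the values of the test, which makes it a canonical choice.
first : ∀ {n} → (Fin n → Bool) → Maybe (Fin n)
first {ℕ.zero}  f = nothing
first {ℕ.suc n} f = if f zero then just zero else Maybe.map suc (first (f ∘ suc))

first-ext : ∀ {n} (f g : Fin n → Bool) → (∀ x → f x ≡ g x) → first f ≡ first g
first-ext {ℕ.zero}  f g f≗g = refl
first-ext {ℕ.suc n} f g f≗g rewrite f≗g zero | first-ext (f ∘ suc) (g ∘ suc) (f≗g ∘ suc) = refl

first-sound : ∀ {n} (f : Fin n → Bool) {y} → first f ≡ just y → f y ≡ true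
first-sound {ℕ.suc n} f {y} found with f zero in f0
first-sound {ℕ.suc n} f {zero} refl | true = f0
first-sound {ℕ.suc n} f {y} found | false with first (f ∘ suc) in found'
first-sound {ℕ.suc n} f {suc y} refl | false | just y = first-sound (f ∘ suc) found'

first-found : ∀ {n} (f : Fin n → Bool) {x} → f x ≡ true → ∃ λ y → first f ≡ just y
first-found {ℕ.suc n} f {x} fx with f zero in f0
... | true = zero , refl
first-found {ℕ.suc n} f {zero} fx | false with () ← trans (sym f0) fx
first-found {ℕ.suc n} f {suc x} fx | false with first-found (f ∘ suc) fx
... | y , found rewrite found = suc y , refl

-- Enumerating a subset S of Fin n: its elements are numbered by
-- Fin (size S) in increasing order. (size S is the cardinality of S,
-- computed by structural recursion so that index and element can be
-- defined by pattern matching.)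
size : ∀ {n} → Subset n → ℕ
size []            = 0
size (inside ∷ S)  = ℕ.suc (size S)
size (outside ∷ S) = size S

index : ∀ {n} (S : Subset n) {x} → x ∈ S → Fin (size S)
index (inside ∷ S)  here        = zero
index (inside ∷ S)  (there x∈S) = suc (index S x∈S)
index (outside ∷ S) (there x∈S) = index S x∈S

element : ∀ {n} (S : Subset n) → Fin (size S) → Fin n
element (inside ∷ S)  zero    = zero
element (inside ∷ S)  (suc i) = suc (element S i)
element (outside ∷ S) i       = suc (element S i)

element∈ : ∀ {n} (S : Subset n) i → element S i ∈ S
element∈ (inside ∷ S)  zero    = here
element∈ (inside ∷ S)  (suc i) = there (element∈ S i)
element∈ (outside ∷ S) i       = there (element∈ S i)

element-index : ∀ {n} (S : Subset n) {x} (x∈S : x ∈ S) → element S (index S x∈S) ≡ x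
element-index (inside ∷ S)  here        = refl
element-index (inside ∷ S)  (there x∈S) = cong suc (element-index S x∈S)
element-index (outside ∷ S) (there x∈S) = cong suc (element-index S x∈S)

index-element : ∀ {n} (S : Subset n) i → index S (element∈ S i) ≡ i
index-element (inside ∷ S)  zero    = refl
index-element (inside ∷ S)  (suc i) = cong suc (index-element S i)
index-element (outside ∷ S) i       = index-element S i

index-cong : ∀ {n} (S : Subset n) {x y} (x∈S : x ∈ S) (y∈S : y ∈ S) → x ≡ y → index S x∈S ≡ index S y∈S
index-cong S x∈S y∈S refl = cong (index S) ([]=-irrelevant x∈S y∈S)

-- The quotient G/M of a FinGroup by a central subgroup M, realised as a
-- FinGroup whose elements are the canonical representatives of the
-- cosets of M, together with the projection π : G → G/M.
module CentralQuotient (G : FinGroup) (M : Subset (order G))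
                       (M≤G : IsSubgroup G M) (M-central : IsCentral G M) where
  open GroupLaws G
  open ≡-Reasoning
  private
    ε∈M = proj₁ M≤G
    ∙-closedM = proj₁ (proj₂ M≤G)
    ⁻¹-closedM = proj₂ (proj₂ M≤G)

  infix 4 _~_
  _~_ : El G → El G → Set
  x ~ y = x ⁻¹ ∙ y ∈ M

  ~-refl : ∀ x → x ~ x
  ~-refl x = subst (_∈ M) (sym (inverseˡ x)) ε∈M

  ~-sym : ∀ {x y} → x ~ y → y ~ x
  ~-sym {x} {y} x~y = subst (_∈ M) (begin
    (x ⁻¹ ∙ y) ⁻¹      ≡⟨ ⁻¹-anti-homo-∙ (x ⁻¹) y ⟩
    y ⁻¹ ∙ x ⁻¹ ⁻¹     ≡⟨ cong (y ⁻¹ ∙_) (⁻¹-involutive x) ⟩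
    y ⁻¹ ∙ x           ∎) (⁻¹-closedM _ x~y)

  ~-trans : ∀ {x y z} → x ~ y → y ~ z → x ~ z
  ~-trans {x} {y} {z} x~y y~z = subst (_∈ M) (begin
    x ⁻¹ ∙ y ∙ (y ⁻¹ ∙ z)     ≡⟨ ∙-assoc (x ⁻¹) y _ ⟩
    x ⁻¹ ∙ (y ∙ (y ⁻¹ ∙ z))   ≡⟨ cong (x ⁻¹ ∙_) (\\-leftDividesˡ y z) ⟩
    x ⁻¹ ∙ z                  ∎) (∙-closedM _ _ x~y y~z)

  -- Cosets of a central subgroup multiply: with m = x⁻¹ x' central,
  -- (x y)⁻¹ (x' y') = y⁻¹ m y' = m (y⁻¹ y').
  ~-∙ : ∀ {x x' y y'} → x ~ x' → y ~ y' → x ∙ y ~ x' ∙ y'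
  ~-∙ {x} {x'} {y} {y'} x~x' y~y' = subst (_∈ M) (begin
    m ∙ (y ⁻¹ ∙ y')             ≡⟨ ∙-assoc m _ y' ⟨
    m ∙ y ⁻¹ ∙ y'               ≡⟨ cong (_∙ y') (M-central m x~x' (y ⁻¹)) ⟩
    y ⁻¹ ∙ m ∙ y'               ≡⟨ ∙-assoc (y ⁻¹) m y' ⟩
    y ⁻¹ ∙ (x ⁻¹ ∙ x' ∙ y')     ≡⟨ cong (y ⁻¹ ∙_) (∙-assoc (x ⁻¹) x' y') ⟩
    y ⁻¹ ∙ (x ⁻¹ ∙ (x' ∙ y'))   ≡⟨ ∙-assoc (y ⁻¹) (x ⁻¹) _ ⟨
    y ⁻¹ ∙ x ⁻¹ ∙ (x' ∙ y')     ≡⟨ cong (_∙ (x' ∙ y')) (⁻¹-anti-homo-∙ x y) ⟨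
    (x ∙ y) ⁻¹ ∙ (x' ∙ y')      ∎) (∙-closedM _ _ x~x' y~y')
    where m = x ⁻¹ ∙ x'

  inCoset : El G → El G → Bool
  inCoset x y = does (x ⁻¹ ∙ y ∈? M)

  rep : El G → El G
  rep x = fromMaybe x (first (inCoset x))

  -- x lies in its own coset, so the search for the first element succeeds
  rep-found : ∀ x → ∃ λ y → first (inCoset x) ≡ just y
  rep-found x = first-found (inCoset x) (dec-true (x ⁻¹ ∙ x ∈? M) (~-refl x))

  rep-~ : ∀ x → x ~ rep x
  rep-~ x = let (y , found) = rep-found x in
    subst (x ~_) (sym (cong (fromMaybe x) found)) (does⇒ (x ⁻¹ ∙ y ∈? M) (first-sound (inCoset x) found))

  -- Equivalent elements have the same coset, hence the same representative.
  rep-resp : ∀ {x x'} → x ~ x' → rep x ≡ rep x'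
  rep-resp {x} {x'} x~x' = let (y , found) = rep-found x in begin
    rep x                          ≡⟨ cong (fromMaybe x) found ⟩
    y                              ≡⟨ cong (fromMaybe x') (trans (sym (first-ext _ _ same-coset)) found) ⟨
    rep x'                         ∎
    where
    same-coset : ∀ y → inCoset x y ≡ inCoset x' y
    same-coset y = does-⇔ (mk⇔ (~-trans (~-sym x~x')) (~-trans x~x')) (x ⁻¹ ∙ y ∈? M) (x' ⁻¹ ∙ y ∈? M)

  -- the elements which are their own representative, one for each coset
  Reps : Subset (order G)
  Reps = decided (λ x → rep x ≟ᶠ x)

  -- (opaque: only its statement is needed, and keeping the proof term from
  -- unfolding keeps conversion checks between values of π cheap)
  opaque
    rep∈Reps : ∀ x → rep x ∈ Reps
    rep∈Reps x = decided⁺ (λ x → rep x ≟ᶠ x) (sym (rep-resp (rep-~ x)))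

  -- The projection onto the quotient, whose elements are the indices of
  -- the representatives, and its section; π x = π y exactly when x ~ y.
  π : El G → Fin (size Reps)
  π x = index Reps (rep∈Reps x)

  lift : Fin (size Reps) → El G
  lift = element Reps

  lift-π : ∀ x → lift (π x) ≡ rep x
  lift-π x = element-index Reps (rep∈Reps x)

  π-lift : ∀ a → π (lift a) ≡ a
  π-lift a = trans (index-cong Reps _ (element∈ Reps a) (decided⁻ (λ x → rep x ≟ᶠ x) (element∈ Reps a)))
                   (index-element Reps a)

  ~-π : ∀ x → x ~ lift (π x)
  ~-π x = subst (x ~_) (sym (lift-π x)) (rep-~ x)

  π-~ : ∀ {x y} → x ~ y → π x ≡ π y
  π-~ x~y = index-cong Reps _ _ (rep-resp x~y)

  π-~⁻ : ∀ {x y} → π x ≡ π y → x ~ y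
  π-~⁻ {x} {y} πx≡πy =
    ~-trans (~-π x) (subst (_~ y) (cong lift (sym πx≡πy)) (~-sym (~-π y)))

  _⋆_ : Fin (size Reps) → Fin (size Reps) → Fin (size Reps)
  a ⋆ b = π (lift a ∙ lift b)

  π-hom : ∀ x y → π (x ∙ y) ≡ π x ⋆ π y
  π-hom x y = π-~ (~-∙ (~-π x) (~-π y))

  -- Every quotient element is π of its lift, so the group laws of G
  -- transfer along the homomorphism π.
  ⋆-assoc : ∀ a b c → (a ⋆ b) ⋆ c ≡ a ⋆ (b ⋆ c)
  ⋆-assoc a b c = begin
    π (x ∙ y) ⋆ c          ≡⟨ cong (π (x ∙ y) ⋆_) (π-lift c) ⟨
    π (x ∙ y) ⋆ π z        ≡⟨ π-hom (x ∙ y) z ⟨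
    π (x ∙ y ∙ z)          ≡⟨ cong π (∙-assoc x y z) ⟩
    π (x ∙ (y ∙ z))        ≡⟨ π-hom x (y ∙ z) ⟩
    π x ⋆ π (y ∙ z)        ≡⟨ cong (_⋆ π (y ∙ z)) (π-lift a) ⟩
    a ⋆ (b ⋆ c)            ∎
    where x = lift a ; y = lift b ; z = lift c

  ⋆-identityˡ : ∀ a → π ε ⋆ a ≡ a
  ⋆-identityˡ a = begin
    π ε ⋆ a           ≡⟨ cong (π ε ⋆_) (π-lift a) ⟨
    π ε ⋆ π (lift a)  ≡⟨ π-hom ε (lift a) ⟨
    π (ε ∙ lift a)    ≡⟨ cong π (identityˡ (lift a)) ⟩
    π (lift a)        ≡⟨ π-lift a ⟩
    a                 ∎

  ⋆-identityʳ : ∀ a → a ⋆ π ε ≡ a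
  ⋆-identityʳ a = begin
    a ⋆ π ε           ≡⟨ cong (_⋆ π ε) (π-lift a) ⟨
    π (lift a) ⋆ π ε  ≡⟨ π-hom (lift a) ε ⟨
    π (lift a ∙ ε)    ≡⟨ cong π (identityʳ (lift a)) ⟩
    π (lift a)        ≡⟨ π-lift a ⟩
    a                 ∎

  ⋆-inverseˡ : ∀ a → π (lift a ⁻¹) ⋆ a ≡ π ε
  ⋆-inverseˡ a = begin
    π (lift a ⁻¹) ⋆ a             ≡⟨ cong (π (lift a ⁻¹) ⋆_) (π-lift a) ⟨
    π (lift a ⁻¹) ⋆ π (lift a)    ≡⟨ π-hom (lift a ⁻¹) (lift a) ⟨
    π (lift a ⁻¹ ∙ lift a)        ≡⟨ cong π (inverseˡ (lift a)) ⟩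
    π ε                           ∎

  ⋆-inverseʳ : ∀ a → a ⋆ π (lift a ⁻¹) ≡ π ε
  ⋆-inverseʳ a = begin
    a ⋆ π (lift a ⁻¹)             ≡⟨ cong (_⋆ π (lift a ⁻¹)) (π-lift a) ⟨
    π (lift a) ⋆ π (lift a ⁻¹)    ≡⟨ π-hom (lift a) (lift a ⁻¹) ⟨
    π (lift a ∙ lift a ⁻¹)        ≡⟨ cong π (inverseʳ (lift a)) ⟩
    π ε                           ∎

  Quotient : FinGroup
  Quotient = record
    { order = size Reps ; _·_ = _⋆_ ; e = π ε ; inv = λ a → π (lift a ⁻¹)
    ; assoc = ⋆-assoc ; idˡ = ⋆-identityˡ ; idʳ = ⋆-identityʳ
    ; invˡ = ⋆-inverseˡ ; invʳ = ⋆-inverseʳ }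

  π-surjective : ∀ a → ∃ λ x → π x ≡ a
  π-surjective a = lift a , π-lift a

  π-kernel : ∀ x → (π x ≡ π ε) ⇔ (x ∈ M)
  π-kernel x = mk⇔ (λ πx≡πε → subst (_∈ M) ε⁻¹∙x≡x (π-~⁻ (sym πx≡πε)))
                   (λ x∈M → sym (π-~ (subst (_∈ M) (sym ε⁻¹∙x≡x) x∈M)))
    where
    ε⁻¹∙x≡x : ε ⁻¹ ∙ x ≡ x
    ε⁻¹∙x≡x = trans (cong (_∙ x) ε⁻¹≈ε) (identityˡ x)

module Pullback (G H : FinGroup) (χ : El G → El H) (χ-hom : IsHom G H χ)
                (χ-surjective : ∀ y → ∃ λ x → χ x ≡ y) where
  private
    module G = GroupLaws G
    module H = GroupLaws H
  open HomLaws G H χ χ-hom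
  open Products using (Factors)
  open ≡-Reasoning

  preimage : Subset (order H) → Subset (order G)
  preimage S = decided (λ x → χ x ∈? S)

  preimage⁺ : ∀ {S x} → χ x ∈ S → x ∈ preimage S
  preimage⁺ {S} = decided⁺ (λ x → χ x ∈? S)

  preimage⁻ : ∀ {S x} → x ∈ preimage S → χ x ∈ S
  preimage⁻ {S} = decided⁻ (λ x → χ x ∈? S)

  preimage-subgroup : ∀ {S} → IsSubgroup H S → IsSubgroup G (preimage S)
  preimage-subgroup {S} (ε∈S , ∙-closed , ⁻¹-closed) =
    preimage⁺ (subst (_∈ S) (sym hom-ε) ε∈S) ,
    (λ x y x∈ y∈ → preimage⁺ (subst (_∈ S) (sym (χ-hom x y)) (∙-closed _ _ (preimage⁻ x∈) (preimage⁻ y∈)))) ,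
    (λ x x∈ → preimage⁺ (subst (_∈ S) (sym (hom-⁻¹ x)) (⁻¹-closed _ (preimage⁻ x∈))))

  preimage-nontrivial : ∀ {S} → (∃ λ y → y ∈ S × y ≢ H.ε) → ∃ λ x → x ∈ preimage S × x ≢ G.ε
  preimage-nontrivial {S} (y , y∈S , y≢ε) = let (x , χx≡y) = χ-surjective y in
    x , preimage⁺ (subst (_∈ S) (sym χx≡y) y∈S) ,
    (λ x≡ε → y≢ε (trans (sym χx≡y) (trans (cong χ x≡ε) hom-ε)))

  preimage-proper : ∀ {S} → (∃ λ y → y ∉ S) → ∃ λ x → x ∉ preimage S
  preimage-proper {S} (y , y∉S) = let (x , χx≡y) = χ-surjective y in
    x , (λ x∈ → y∉S (subst (_∈ S) χx≡y (preimage⁻ x∈)))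

  -- If χ g = a b, lift a to x₁; then g = x₁ (x₁⁻¹ g) with χ (x₁⁻¹ g) = b.
  preimage-cover : ∀ {A B} → (∀ y → Factors H A B y) → ∀ g → Factors G (preimage A) (preimage B) g
  preimage-cover {A} {B} H=AB g =
    let (a , b , a∈A , b∈B , χg≡ab) = H=AB (χ g)
        (x₁ , χx₁≡a) = χ-surjective a
    in
    x₁ , x₁ G.⁻¹ G.∙ g , preimage⁺ (subst (_∈ A) (sym χx₁≡a) a∈A) ,
    preimage⁺ (subst (_∈ B) (sym (begin
      χ (x₁ G.⁻¹ G.∙ g)          ≡⟨ χ-hom _ g ⟩
      χ (x₁ G.⁻¹) H.∙ χ g        ≡⟨ cong₂ H._∙_ (trans (hom-⁻¹ x₁) (cong H._⁻¹ χx₁≡a)) χg≡ab ⟩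
      a H.⁻¹ H.∙ (a H.∙ b)       ≡⟨ H.\\-leftDividesʳ a b ⟩
      b                          ∎)) b∈B) ,
    sym (G.\\-leftDividesˡ x₁ g)

  pullback-decomposition : ∀ {A B} → IsCentralDecomposition H A B →
    (∀ x y → χ x ∈ A → χ y ∈ B → G.[ x , y ] ≡ G.ε) →
    IsCentralDecomposition G (preimage A) (preimage B)
  pullback-decomposition (A≤H , B≤H , A-nontrivial , B-nontrivial , A-proper , B-proper , _ , H=AB) commute =
    preimage-subgroup A≤H , preimage-subgroup B≤H ,
    preimage-nontrivial A-nontrivial , preimage-nontrivial B-nontrivial ,
    preimage-proper A-proper , preimage-proper B-proper ,
    (λ x y x∈ y∈ → commute x y (preimage⁻ x∈) (preimage⁻ y∈)) ,
    preimage-cover H=AB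

-- The map P/(N ∩ D) → P/N is a surjective homomorphism along which the
-- decomposition pulls back; the preimages commute because a commutator
-- lies in D and, mapping to a commutator of the commuting factors of
-- P/N, also in N.
module QuotientDecomposition (P : FinGroup) (D : Subset (order P))
                             (D≤P : IsSubgroup P D) (comm∈D : ∀ x y → comm P x y ∈ D)
                             (N : Subset (order P)) (N≤P : IsSubgroup P N) (N-central : IsCentral P N) where
  open GroupLaws P

  intersection-subgroup : IsSubgroup P (N ∩ D)
  intersection-subgroup =
    x∈p∩q⁺ (proj₁ N≤P , proj₁ D≤P) ,
    (λ x y x∈ y∈ → let (x∈N , x∈D) = x∈p∩q⁻ N D x∈ ; (y∈N , y∈D) = x∈p∩q⁻ N D y∈ in
       x∈p∩q⁺ (proj₁ (proj₂ N≤P) x y x∈N y∈N , proj₁ (proj₂ D≤P) x y x∈D y∈D)) ,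
    (λ x x∈ → let (x∈N , x∈D) = x∈p∩q⁻ N D x∈ in
       x∈p∩q⁺ (proj₂ (proj₂ N≤P) x x∈N , proj₂ (proj₂ D≤P) x x∈D))

  intersection-central : IsCentral P (N ∩ D)
  intersection-central x x∈ = N-central x (proj₁ (x∈p∩q⁻ N D x∈))

  open CentralQuotient P (N ∩ D) intersection-subgroup intersection-central

  quotient-decomposition : QuotientAdmitsCD P N → QuotientAdmitsCD P (N ∩ D)
  quotient-decomposition (Q , φ , φ-hom , φ-surjective , φ-kernel , A , B , Q=AB@(_ , _ , _ , _ , _ , _ , [A,B]=1 , _)) =
    Quotient , π , π-hom , π-surjective , π-kernel ,
    preimage A , preimage B , pullback-decomposition Q=AB commute
    where
    open HomLaws P Q φ φ-hom using (hom-comm; hom-coset)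
    open HomLaws P Quotient π π-hom using () renaming (hom-comm to π-comm)

    χ : El Quotient → El Q
    χ a = φ (lift a)

    χ-π : ∀ x → χ (π x) ≡ φ x
    χ-π x = hom-coset (lift (π x)) x
      (Equivalence.from (φ-kernel _) (proj₁ (x∈p∩q⁻ N D (~-sym (~-π x)))))

    χ-hom : IsHom Quotient Q χ
    χ-hom a b = trans (χ-π (lift a ∙ lift b)) (φ-hom (lift a) (lift b))

    χ-surjective : ∀ y → ∃ λ a → χ a ≡ y
    χ-surjective y = let (x , φx≡y) = φ-surjective y in π x , trans (χ-π x) φx≡y

    open Pullback Quotient Q χ χ-hom χ-surjective

    commute : ∀ a b → χ a ∈ A → χ b ∈ B → comm Quotient a b ≡ π ε
    commute a b χa∈A χb∈B = begin
      comm Quotient a b                       ≡⟨ cong₂ (comm Quotient) (π-lift a) (π-lift b) ⟨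
      comm Quotient (π (lift a)) (π (lift b)) ≡⟨ π-comm (lift a) (lift b) ⟨
      π [ lift a , lift b ]                   ≡⟨ Equivalence.from (π-kernel _) (x∈p∩q⁺ (comm∈N , comm∈D _ _)) ⟩
      π ε                                     ∎
      where
      open ≡-Reasoning
      comm∈N : [ lift a , lift b ] ∈ N
      comm∈N = Equivalence.to (φ-kernel _) (trans (hom-comm (lift a) (lift b)) ([A,B]=1 _ _ χa∈A χb∈B))

prime>1 : ∀ {p} → Prime p → 1 < p
prime>1 {p} p-prime = nonTrivial⇒n>1 p {{prime⇒nonTrivial p-prime}}

^-cancelʳ-≤ : ∀ {p} → 1 < p → ∀ {a b} → p ^ a ≤ p ^ b → a ≤ b
^-cancelʳ-≤ {p} 1<p pᵃ≤pᵇ = ≮⇒≥ (λ b<a → <⇒≱ (^-monoʳ-< p 1<p b<a) pᵃ≤pᵇ)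

^-cancelʳ-< : ∀ {p} → 1 < p → ∀ {a b} → p ^ a < p ^ b → a < b
^-cancelʳ-< {ℕ.suc p} 1<p pᵃ<pᵇ = ≰⇒> (λ b≤a → <⇒≱ pᵃ<pᵇ (^-monoʳ-≤ (ℕ.suc p) b≤a))

module Degree (p : ℕ) (1<p : 1 < p) (n m : ℕ) (P : FinGroup) (D : Subset (order P))
              (D-central : IsCentral P D) (|P| : order P ≡ p ^ n * ∣ D ∣) (|D| : ∣ D ∣ ≡ p ^ m) where
  open GroupLaws P

  ∈centralizer : ∀ {g h} → h ∙ g ≡ g ∙ h → h ∈ centralizer P g
  ∈centralizer {g} = decided⁺ (λ h → h ∙ g ≟ᶠ g ∙ h)

  central⇒centralizer-full : ∀ {g} → g ∈ D → ⊤ ⊆ centralizer P g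
  central⇒centralizer-full g∈D {h} _ = ∈centralizer (sym (D-central _ g∈D h))

  -- D centralizes g, and g ∉ D centralizes itself
  D⊂centralizer : ∀ {g} → g ∉ D → D ⊂ centralizer P g
  D⊂centralizer {g} g∉D =
    (λ {h} h∈D → ∈centralizer (D-central h h∈D g)) , g , ∈centralizer refl , g∉D

  degree-bound : ∀ g d → ∣ centralizer P g ∣ ≡ p ^ d → n + m ∸ d ≤ n ∸ 1
  degree-bound g d |C[g]| with g ∈? D
  -- g ∈ D: p^(n+m) = |P| ≤ |C_P(g)| = p^d, so the left side vanishes
  ... | yes g∈D = subst (_≤ n ∸ 1) (sym (m≤n⇒m∸n≡0 n+m≤d)) z≤n
    where
    n+m≤d : n + m ≤ d
    n+m≤d = ^-cancelʳ-≤ 1<p (begin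
      p ^ (n + m)           ≡⟨ ^-distribˡ-+-* p n m ⟩
      p ^ n * p ^ m         ≡⟨ cong (p ^ n *_) |D| ⟨
      p ^ n * ∣ D ∣         ≡⟨ |P| ⟨
      order P               ≡⟨ ∣⊤∣≡n (order P) ⟨
      ∣ ⊤ {order P} ∣       ≤⟨ p⊆q⇒∣p∣≤∣q∣ (central⇒centralizer-full g∈D) ⟩
      ∣ centralizer P g ∣   ≡⟨ |C[g]| ⟩
      p ^ d                 ∎)
      where open ≤-Reasoning
  -- g ∉ D: p^m = |D| < |C_P(g)| = p^d, so m < d
  ... | no g∉D = begin
    n + m ∸ d         ≤⟨ ∸-monoʳ-≤ (n + m) m<d ⟩
    n + m ∸ suc m     ≡⟨ cong (n + m ∸_) (+-comm 1 m) ⟩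
    n + m ∸ (m + 1)   ≡⟨ ∸-+-assoc (n + m) m 1 ⟨
    n + m ∸ m ∸ 1     ≡⟨ cong (_∸ 1) (m+n∸n≡m n m) ⟩
    n ∸ 1             ∎
    where
    open ≤-Reasoning
    m<d : m < d
    m<d = ^-cancelʳ-< 1<p (subst₂ _<_ |D| |C[g]| (p⊂q⇒∣p∣<∣q∣ (D⊂centralizer g∉D)))

mainTheorem6 : (p : ℕ) → Prime p → ¬ (p ≡ 2) →
    (n m : ℕ) (P : FinGroup) (D : Subset (order P)) →
    IsDerivedSubgroup P D → InB p n m P D →
      ((J K : Subset (order P)) → IsCentralDecomposition P J K →
         IsCentralDecomposition P (prodSet P J D) (prodSet P K D)
         × D ⊂ prodSet P J D × D ⊂ prodSet P K D)
    × ((N : Subset (order P)) → IsSubgroup P N → IsCentral P N →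
         QuotientAdmitsCD P N → QuotientAdmitsCD P (N ∩ D))
    × ((g : El P) (d : ℕ) → ∣ centralizer P g ∣ ≡ p ^ d →
         n + m ∸ d ≤ n ∸ 1)
mainTheorem6 p p-prime _ n m P D D-derived@(D≤P , comm∈D , _) (_ , _ , D-central , |P| , |D|) =
  (λ J K → decomposition-with-derived) ,
  (λ N N≤P N-central → QuotientDecomposition.quotient-decomposition P D D≤P comm∈D N N≤P N-central) ,
  degree-bound
  where
  open DerivedProducts P D D-derived D-central using (decomposition-with-derived)
  open Degree p (prime>1 p-prime) n m P D D-central |P| |D| using (degree-bound)
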